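{- For every permutation $\pi\in S_n$, $A_\pi=F(P_\pi)+B_{n+1}$ over $\mathbb F_2$, where $A_\pi$ is the adjacency matrix of $\pi$ and $P_\pi$ its precedence matrix.
   Context: Frame $\pi=[a_1,\dots,a_n]$ as $0,a_1,\dots,a_n,n+1$; each entry $k$ has a left pointer $(k-1,k)$ immediately left and right pointer $(k,k+1)$ immediately right (none left of $0$, none right of $n+1$). $A_\pi$ is the $(n+1)\times(n+1)$ matrix over $\mathbb F_2$ with $A_\pi(i,j)=1$ iff the pointers $(i-1,i)$ and $(j-1,j)$ interleave (exactly one occurrence of one lies strictly between the two occurrences of the other). Let $f_\pi(0)=0$, $f_\pi(a_i)=i$, $f_\pi(n+1)=n+1$; $P_\pi$ is the $(n+2)\times(n+2)$ matrix with $P_\pi(i,j)=1$ iff $f_\pi(i-1)<f_\pi(j-1)$. For an $m\times m$ matrix $P$, $F(P)$ is the $(m-1)\times(m-1)$ matrix with $F(P)(i,j)=P(i,j)+P(i+1,j)+P(i,j+1)+P(i+1,j+1)$ over $\mathbb F_2$. $B_k$ is the $k\times k$ matrix with $B_k(i,j)=1$ iff $i=j$ or $i+1=j$. -}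

module Defs where

open import Data.Nat using (ℕ; zero; suc; _+_; _*_; _<_; _<?_; _⊔_; _⊓_)
open import Data.Bool using (Bool; true; false; _xor_; _∧_; _∨_)
open import Data.Fin using (Fin; zero; suc; toℕ; fromℕ<; inject₁)
open import Data.Fin.Permutation using (Permutation′; _⟨$⟩ʳ_; _⟨$⟩ˡ_)
open import Relation.Nullary.Decidable using (⌊_⌋; yes; no)
open import Data.Fin using (_≟_)

-- Square matrices over 𝔽₂, with 𝔽₂ represented by Bool (addition = xor).
-- Indices are 0-based: row/column i (0-based) is row/column i+1 of the paper.
Mat : ℕ → Set
Mat m = Fin m → Fin m → Bool

_⊕_ : ∀ {m} → Mat m → Mat m → Mat m
(M ⊕ N) i j = M i j xor N i j

-- A permutation π ∈ S_n is a bijection Fin n ↔ Fin n; in 0-based terms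
-- a_{i+1} = 1 + toℕ (π ⟨$⟩ʳ i).

-- f_π : {0,…,n+1} → ℕ, the position of a value in the framed word
-- 0, a_1, …, a_n, n+1.  f_π(0)=0, f_π(a_i)=i, f_π(n+1)=n+1.
fπ : ∀ {n} → Permutation′ n → Fin (suc (suc n)) → ℕ
fπ {n} π zero = 0
fπ {n} π (suc k) with toℕ k <? n
... | yes k<n = suc (toℕ (π ⟨$⟩ˡ fromℕ< k<n))
... | no  _   = suc n

-- Precedence matrix P_π ((n+2)×(n+2)): P(i,j)=1 iff f(i-1) < f(j-1) (1-based),
-- i.e. with 0-based indices i,j: f(i) < f(j).
Pπ : ∀ {n} → Permutation′ n → Mat (suc (suc n))
Pπ π i j = ⌊ fπ π i <? fπ π j ⌋

F : ∀ {k} → Mat (suc k) → Mat k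
F P i j = P (inject₁ i) (inject₁ j) xor P (suc i) (inject₁ j)
          xor P (inject₁ i) (suc j) xor P (suc i) (suc j)

B : ∀ k → Mat k
B k i j = ⌊ i ≟ j ⌋ ∨ ⌊ suc (toℕ i) Data.Nat.≟ toℕ j ⌋

-- The framed word is expanded as the sequence in which
-- each entry v at position p = f_π(v) is preceded by its left pointer (v-1,v)
-- (slot 3p) and followed by its right pointer (v,v+1) (slot 3p+2); the entry
-- itself sits at slot 3p+1.  (Slots for the nonexistent left pointer of 0 and
-- right pointer of n+1 are simply unused.)
-- The pointer (k-1,k), k = 1..n+1, indexed 0-based by Fin (n+1) as k-1,
-- has occurrences: right of entry k-1 and left of entry k.
occ₁ occ₂ : ∀ {n} → Permutation′ n → Fin (suc n) → ℕ
occ₁ π i = 3 * fπ π (inject₁ i) + 2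
occ₂ π i = 3 * fπ π (suc i)

between : ℕ → ℕ → ℕ → Bool
between x a b = ⌊ (a ⊓ b) <? x ⌋ ∧ ⌊ x <? (a ⊔ b) ⌋

interleave : ∀ {n} → Permutation′ n → Fin (suc n) → Fin (suc n) → Bool
interleave π p q =
  between (occ₁ π q) (occ₁ π p) (occ₂ π p) xor between (occ₂ π q) (occ₁ π p) (occ₂ π p)

-- Adjacency matrix A_π ((n+1)×(n+1)): A(i,j)=1 iff pointers (i-1,i),(j-1,j)
-- interleave (1-based); 0-based index i ↦ pointer (i,i+1).
Aπ : ∀ {n} → Permutation′ n → Mat (suc n)
Aπ π = interleave π

-- A point x ∉ {u, v} lies strictly between u and v exactly when [u < x] + [v < x] = 1
-- over 𝔽₂. Entry k at position f(k) owns the slots 3f(k) (left pointer) and 3f(k)+2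
-- (right pointer), and slots compare lexicographically by (position, offset). Summing
-- over the two occurrences of pointer q inside the chord of pointer p therefore gives
-- the four precedence entries [f(p) < f(q)], [f(p+1) < f(q)], [f(p) < f(q+1)],
-- [f(p+1) < f(q+1)], i.e. F(P)(p,q), except that the left pointer of p+1 precedes the
-- right pointer of q also when f(p+1) = f(q), i.e. q = p+1: the superdiagonal of B.
-- On the diagonal A vanishes, while F(P) and B are both 1 because f(p) ≠ f(p+1).
module Submission where

open import Defs
open import Data.Bool using (true; false; _xor_)
open import Data.Bool.Properties using (xor-assoc; xor-comm; xor-identityʳ; ∧-identityʳ; ∧-zeroʳ)
open import Data.Fin using (zero; suc; toℕ; inject₁)
import Data.Fin as Fin
open import Data.Fin.Properties using (toℕ-injective; toℕ-inject₁; toℕ<n; toℕ≤pred[n]; fromℕ<-injective; inject₁-injective)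
  renaming (suc-injective to Fin-suc-injective)
open import Data.Fin.Permutation using (Permutation′; _⟨$⟩ʳ_; _⟨$⟩ˡ_; inverseʳ)
open import Data.Nat using (ℕ; suc; _+_; _*_; _<_; _≤_; _⊓_; _⊔_; _<?_; _≟_; z≤n; z<s)
open import Data.Nat.Properties
open import Data.Sum using (_⊎_; inj₁; inj₂)
open import Function using (_∘_; _⇔_; mk⇔)
open import Function.Definitions using (Injective)
open import Relation.Binary using (tri<; tri≈; tri>)
open import Relation.Binary.PropositionalEquality
open import Relation.Nullary using (Dec; ¬_; contradiction)
open import Relation.Nullary.Decidable using (⌊_⌋; yes; no; dec-true; dec-false; does-⇔; isYes≗does)

private
  variable
    A : Set
    u v x : ℕ

⌊⌋-true : (a? : Dec A) → A → ⌊ a? ⌋ ≡ true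
⌊⌋-true a? p = trans (isYes≗does a?) (dec-true a? p)

⌊⌋-false : (a? : Dec A) → ¬ A → ⌊ a? ⌋ ≡ false
⌊⌋-false a? ¬p = trans (isYes≗does a?) (dec-false a? ¬p)

⌊⌋-cong : ∀ {B : Set} → A ⇔ B → (a? : Dec A) (b? : Dec B) → ⌊ a? ⌋ ≡ ⌊ b? ⌋
⌊⌋-cong A⇔B a? b? = trans (isYes≗does a?) (trans (does-⇔ A⇔B a? b?) (sym (isYes≗does b?)))

⌊<?⌋-irrefl : ∀ a → ⌊ a <? a ⌋ ≡ false
⌊<?⌋-irrefl a = ⌊⌋-false (a <? a) (<-irrefl refl)

between-sym : ∀ x u v → between x u v ≡ between x v u
between-sym x u v rewrite ⊓-comm u v | ⊔-comm u v = refl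

between-endˡ : ∀ u v → between u u v ≡ false
between-endˡ u v with ≤-total u v
... | inj₁ u≤v rewrite m≤n⇒m⊓n≡m u≤v | ⌊<?⌋-irrefl u = refl
... | inj₂ v≤u rewrite m≥n⇒m⊔n≡m v≤u | ⌊<?⌋-irrefl u = ∧-zeroʳ _

between-≤ : u ≤ v → x ≢ v → between x u v ≡ ⌊ u <? x ⌋ xor ⌊ v <? x ⌋
between-≤ {u} {v} {x} u≤v x≢v rewrite m≤n⇒m⊓n≡m u≤v | m≤n⇒m⊔n≡n u≤v with <-cmp x v
... | tri< x<v _ _ rewrite ⌊⌋-true (x <? v) x<v | ⌊⌋-false (v <? x) (<⇒≯ x<v) =
  trans (∧-identityʳ _) (sym (xor-identityʳ _))
... | tri≈ _ x≡v _ = contradiction x≡v x≢v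
... | tri> _ _ v<x rewrite ⌊⌋-false (x <? v) (<⇒≯ v<x) | ⌊⌋-true (v <? x) v<x
                         | ⌊⌋-true (u <? x) (≤-<-trans u≤v v<x) = refl

between-xor : x ≢ u → x ≢ v → between x u v ≡ ⌊ u <? x ⌋ xor ⌊ v <? x ⌋
between-xor {x} {u} {v} x≢u x≢v with ≤-total u v
... | inj₁ u≤v = between-≤ u≤v x≢v
... | inj₂ v≤u = begin
  between x u v              ≡⟨ between-sym x u v ⟩
  between x v u              ≡⟨ between-≤ v≤u x≢u ⟩
  ⌊ v <? x ⌋ xor ⌊ u <? x ⌋  ≡⟨ xor-comm ⌊ v <? x ⌋ ⌊ u <? x ⌋ ⟩
  ⌊ u <? x ⌋ xor ⌊ v <? x ⌋  ∎
  where open ≡-Reasoning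

slot-< : ∀ {a c r s} → r < 3 → a < c → 3 * a + r < 3 * c + s
slot-< {a} {c} {r} {s} r<3 a<c = begin-strict
  3 * a + r  <⟨ +-monoʳ-< (3 * a) r<3 ⟩
  3 * a + 3  ≡⟨ +-comm (3 * a) 3 ⟩
  3 + 3 * a  ≡⟨ sym (*-suc 3 a) ⟩
  3 * suc a  ≤⟨ *-monoʳ-≤ 3 a<c ⟩
  3 * c      ≤⟨ m≤m+n (3 * c) s ⟩
  3 * c + s  ∎
  where open ≤-Reasoning

slot-≢ : ∀ {a c r s} → r < 3 → s < 3 → a ≢ c ⊎ r ≢ s → 3 * a + r ≢ 3 * c + s
slot-≢ {a} {c} {r} {s} r<3 s<3 a≢c⊎r≢s e with <-cmp a c | a≢c⊎r≢s
... | tri< a<c _ _  | _        = <⇒≢ (slot-< r<3 a<c) e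
... | tri> _ _ c<a  | _        = <⇒≢ (slot-< s<3 c<a) (sym e)
... | tri≈ _ a≡c _  | inj₁ a≢c = a≢c a≡c
... | tri≈ _ refl _ | inj₂ r≢s = r≢s (+-cancelˡ-≡ (3 * a) r s e)

⌊<?⌋-slot-≥ : ∀ {a c r s} → s ≤ r → r < 3 → ⌊ 3 * a + r <? 3 * c + s ⌋ ≡ ⌊ a <? c ⌋
⌊<?⌋-slot-≥ {a} {c} {r} {s} s≤r r<3 with <-cmp a c
... | tri< a<c _ _ = trans (⌊⌋-true (3 * a + r <? 3 * c + s) (slot-< r<3 a<c))
                          (sym (⌊⌋-true (a <? c) a<c))
... | tri≈ _ refl _ = trans (⌊⌋-false (3 * a + r <? 3 * a + s) (≤⇒≯ (+-monoʳ-≤ (3 * a) s≤r)))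
                           (sym (⌊<?⌋-irrefl a))
... | tri> a≮c _ c<a = trans (⌊⌋-false (3 * a + r <? 3 * c + s) (<⇒≯ (slot-< (≤-<-trans s≤r r<3) c<a)))
                            (sym (⌊⌋-false (a <? c) a≮c))

⌊<?⌋-slot-< : ∀ {a c r s} → r < s → s < 3 → ⌊ 3 * a + r <? 3 * c + s ⌋ ≡ ⌊ a <? c ⌋ xor ⌊ a ≟ c ⌋
⌊<?⌋-slot-< {a} {c} {r} {s} r<s s<3 with <-cmp a c
... | tri< a<c a≢c _ rewrite ⌊⌋-true (3 * a + r <? 3 * c + s) (slot-< (<-trans r<s s<3) a<c)
                           | ⌊⌋-true (a <? c) a<c | ⌊⌋-false (a ≟ c) a≢c = refl
... | tri≈ _ refl _ rewrite ⌊⌋-true (3 * a + r <? 3 * a + s) (+-monoʳ-< (3 * a) r<s)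
                          | ⌊<?⌋-irrefl a | ⌊⌋-true (a ≟ a) refl = refl
... | tri> a≮c a≢c c<a rewrite ⌊⌋-false (3 * a + r <? 3 * c + s) (<⇒≯ (slot-< s<3 c<a))
                             | ⌊⌋-false (a <? c) a≮c | ⌊⌋-false (a ≟ c) a≢c = refl

⌊<?⌋-distinct-square : ∀ {a b} → a ≢ b →
  ⌊ a <? a ⌋ xor (⌊ b <? a ⌋ xor (⌊ a <? b ⌋ xor ⌊ b <? b ⌋)) ≡ true
⌊<?⌋-distinct-square {a} {b} a≢b rewrite ⌊<?⌋-irrefl a | ⌊<?⌋-irrefl b with <-cmp a b
... | tri< a<b _ _ rewrite ⌊⌋-false (b <? a) (<⇒≯ a<b) | ⌊⌋-true (a <? b) a<b = refl
... | tri≈ _ a≡b _ = contradiction a≡b a≢b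
... | tri> _ _ b<a rewrite ⌊⌋-true (b <? a) b<a | ⌊⌋-false (a <? b) (<⇒≯ b<a) = refl

xor-move-to-end : ∀ w x y z e → (w xor (x xor e)) xor (y xor z) ≡ (w xor (x xor (y xor z))) xor e
xor-move-to-end w x y z e = begin
  (w xor (x xor e)) xor (y xor z)  ≡⟨ xor-assoc w (x xor e) (y xor z) ⟩
  w xor ((x xor e) xor (y xor z))  ≡⟨ cong (w xor_) (xor-assoc x e (y xor z)) ⟩
  w xor (x xor (e xor (y xor z)))  ≡⟨ cong (λ t → w xor (x xor t)) (xor-comm e (y xor z)) ⟩
  w xor (x xor ((y xor z) xor e))  ≡⟨ cong (w xor_) (xor-assoc x (y xor z) e) ⟨
  w xor ((x xor (y xor z)) xor e)  ≡⟨ xor-assoc w (x xor (y xor z)) e ⟨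
  (w xor (x xor (y xor z))) xor e  ∎
  where open ≡-Reasoning

interleave-as-precedence : ∀ {a b c d} → c ≢ a → d ≢ b →
  between (3 * c + 2) (3 * a + 2) (3 * b) xor between (3 * d) (3 * a + 2) (3 * b)
  ≡ (⌊ a <? c ⌋ xor (⌊ b <? c ⌋ xor (⌊ a <? d ⌋ xor ⌊ b <? d ⌋))) xor ⌊ b ≟ c ⌋
interleave-as-precedence {a} {b} {c} {d} c≢a d≢b
  -- the slot lemmas are stated for 3 * y + offset, so the left-pointer slots get offset 0
  rewrite sym (+-identityʳ (3 * b)) | sym (+-identityʳ (3 * d)) = begin
  between (3 * c + 2) (3 * a + 2) (3 * b + 0) xor between (3 * d + 0) (3 * a + 2) (3 * b + 0)
    ≡⟨ cong₂ _xor_ (between-xor (slot-≢ {c} {a} 2<3 2<3 (inj₁ c≢a)) (slot-≢ {c} {b} 2<3 0<3 (inj₂ λ ())))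
                   (between-xor (slot-≢ {d} {a} 0<3 2<3 (inj₂ λ ())) (slot-≢ {d} {b} 0<3 0<3 (inj₁ d≢b))) ⟩
  (⌊ 3 * a + 2 <? 3 * c + 2 ⌋ xor ⌊ 3 * b + 0 <? 3 * c + 2 ⌋)
    xor (⌊ 3 * a + 2 <? 3 * d + 0 ⌋ xor ⌊ 3 * b + 0 <? 3 * d + 0 ⌋)
    ≡⟨ cong₂ _xor_ (cong₂ _xor_ (⌊<?⌋-slot-≥ {a} {c} ≤-refl 2<3) (⌊<?⌋-slot-< {b} {c} 0<2 2<3))
                   (cong₂ _xor_ (⌊<?⌋-slot-≥ {a} {d} z≤n 2<3) (⌊<?⌋-slot-≥ {b} {d} z≤n 0<3)) ⟩
  (⌊ a <? c ⌋ xor (⌊ b <? c ⌋ xor ⌊ b ≟ c ⌋)) xor (⌊ a <? d ⌋ xor ⌊ b <? d ⌋)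
    ≡⟨ xor-move-to-end ⌊ a <? c ⌋ ⌊ b <? c ⌋ ⌊ a <? d ⌋ ⌊ b <? d ⌋ ⌊ b ≟ c ⌋ ⟩
  (⌊ a <? c ⌋ xor (⌊ b <? c ⌋ xor (⌊ a <? d ⌋ xor ⌊ b <? d ⌋))) xor ⌊ b ≟ c ⌋
    ∎
  where
  open ≡-Reasoning
  0<2 : 0 < 2
  0<2 = z<s
  0<3 : 0 < 3
  0<3 = z<s
  2<3 : 2 < 3
  2<3 = ≤-refl

⟨$⟩ˡ-injective : ∀ {n} (π : Permutation′ n) → Injective _≡_ _≡_ (π ⟨$⟩ˡ_)
⟨$⟩ˡ-injective π e = trans (sym (inverseʳ π)) (trans (cong (π ⟨$⟩ʳ_) e) (inverseʳ π))

fπ-suc-positive : ∀ {n} (π : Permutation′ n) k → 0 < fπ π (suc k)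
fπ-suc-positive {n} π k with toℕ k <? n
... | yes _ = z<s
... | no _  = z<s

fπ-suc-injective : ∀ {n} (π : Permutation′ n) {i j} → fπ π (suc i) ≡ fπ π (suc j) → i ≡ j
fπ-suc-injective {n} π {i} {j} e with toℕ i <? n | toℕ j <? n
... | yes i<n | yes j<n = toℕ-injective (fromℕ<-injective (toℕ i) (toℕ j) i<n j<n
                            (⟨$⟩ˡ-injective π (toℕ-injective (suc-injective e))))
... | yes _   | no _    = contradiction (suc-injective e) (<⇒≢ (toℕ<n _))
... | no _    | yes _   = contradiction (sym (suc-injective e)) (<⇒≢ (toℕ<n _))
... | no i≮n  | no j≮n  = toℕ-injective (trans (last i i≮n) (sym (last j j≮n)))
  where
  last : ∀ k → ¬ toℕ k < n → toℕ k ≡ n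
  last k k≮n = ≤-antisym (toℕ≤pred[n] k) (≮⇒≥ k≮n)

fπ-injective : ∀ {n} (π : Permutation′ n) → Injective _≡_ _≡_ (fπ π)
fπ-injective π {zero}  {zero}  _ = refl
fπ-injective π {zero}  {suc j} e = contradiction e (<⇒≢ (fπ-suc-positive π j))
fπ-injective π {suc i} {zero}  e = contradiction (sym e) (<⇒≢ (fπ-suc-positive π i))
fπ-injective π {suc i} {suc j} e = cong suc (fπ-suc-injective π e)

fπ-suc≡fπ-inject₁ : ∀ {n} (π : Permutation′ n) p q →
  fπ π (suc p) ≡ fπ π (inject₁ q) ⇔ suc (toℕ p) ≡ toℕ q
fπ-suc≡fπ-inject₁ π p q = mk⇔
  (λ e → trans (cong toℕ (fπ-injective π e)) (toℕ-inject₁ q))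
  (λ e → cong (fπ π) (toℕ-injective (trans e (sym (toℕ-inject₁ q)))))

Aπ-diagonal : ∀ {n} (π : Permutation′ n) p → Aπ π p p ≡ false
Aπ-diagonal π p = cong₂ _xor_ (between-endˡ (occ₁ π p) (occ₂ π p))
  (trans (between-sym (occ₂ π p) (occ₁ π p) (occ₂ π p)) (between-endˡ (occ₂ π p) (occ₁ π p)))

F-Pπ-diagonal : ∀ {n} (π : Permutation′ n) p → F (Pπ π) p p ≡ true
F-Pπ-diagonal π p = ⌊<?⌋-distinct-square (λ e → inject₁≢suc (fπ-injective π e))
  where
  inject₁≢suc : inject₁ p ≢ suc p
  inject₁≢suc e = 1+n≢n (trans (cong toℕ (sym e)) (toℕ-inject₁ p))

Aπ-off-diagonal : ∀ {n} (π : Permutation′ n) {p q} → p ≢ q →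
  Aπ π p q ≡ F (Pπ π) p q xor ⌊ suc (toℕ p) ≟ toℕ q ⌋
Aπ-off-diagonal π {p} {q} p≢q = begin
  Aπ π p q                                 ≡⟨ interleave-as-precedence c≢a d≢b ⟩
  F (Pπ π) p q xor ⌊ fπ π (suc p) ≟ fπ π (inject₁ q) ⌋
    ≡⟨ cong (F (Pπ π) p q xor_) (⌊⌋-cong (fπ-suc≡fπ-inject₁ π p q) _ _) ⟩
  F (Pπ π) p q xor ⌊ suc (toℕ p) ≟ toℕ q ⌋  ∎
  where
  open ≡-Reasoning
  c≢a : fπ π (inject₁ q) ≢ fπ π (inject₁ p)
  c≢a = p≢q ∘ sym ∘ inject₁-injective ∘ fπ-injective π
  d≢b : fπ π (suc q) ≢ fπ π (suc p)
  d≢b = p≢q ∘ sym ∘ Fin-suc-injective ∘ fπ-injective π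

mainTheorem12 : (n : ℕ) (π : Permutation′ n) →
    ∀ i j → Aπ π i j ≡ (F (Pπ π) ⊕ B (suc n)) i j
mainTheorem12 n π i j with i Fin.≟ j
... | yes refl = trans (Aπ-diagonal π i) (cong (_xor true) (sym (F-Pπ-diagonal π i)))
... | no i≢j   = Aπ-off-diagonal π i≢j
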